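{- Let $G$ be a connected graph with minimum degree $\delta$. Let $S_0\subseteq V(G)$ and let $S_1$ be a proper subset of $S_0$ such that $N(S_1)\subseteq S_0$. If there exists $\alpha\in S_0$ with $N(\alpha)\not\subseteq S_0$, then there exists a path in $G$ with at least $|S_1|+\delta-|S_0|+1$ vertices, all lying outside $S_0$, starting from a neighbour of $\alpha$ outside $S_0$.
   Context: All graphs are simple. For $S\subseteq V(G)$, $N(S)=\bigcup_{v\in S}N(v)$, where $N(v)$ is the set of neighbours of $v$. -}

module Defs where

open import Data.Nat using (ℕ)
open import Data.Bool using (Bool; T)
open import Data.Fin using (Fin)
open import Data.Fin.Subset using (Subset; ⋃; _∈_)
open import Data.Fin.Subset.Properties using (_∈?_)
open import Data.Fin.Subset using (∣_∣)
open import Data.Vec using (tabulate)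
open import Data.List using (List; []; _∷_; filter; map; last; allFin)
open import Data.List.Relation.Unary.Linked using (Linked)
open import Data.Maybe using (just)
open import Data.Product using (Σ; _×_; ∃)
open import Relation.Binary.PropositionalEquality using (_≡_)
open import Relation.Nullary using (¬_)
open import Data.Empty using (⊥)
open import Data.List.Relation.Unary.Unique.Propositional using (Unique)

record Graph (n : ℕ) : Set where
  field
    adj   : Fin n → Fin n → Bool
    sym   : ∀ u v → adj u v ≡ adj v u
    irrefl : ∀ v → adj v v ≡ Data.Bool.false

open Graph public

Adj : ∀ {n} → Graph n → Fin n → Fin n → Set
Adj G u v = T (adj G u v)

N : ∀ {n} → Graph n → Fin n → Subset n
N G v = tabulate (adj G v)

NSet : ∀ {n} → Graph n → Subset n → Subset n
NSet {n} G S = ⋃ (map (N G) (filter (_∈? S) (allFin n)))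

deg : ∀ {n} → Graph n → Fin n → ℕ
deg G v = ∣ N G v ∣

IsMinDegree : ∀ {n} → Graph n → ℕ → Set
IsMinDegree G δ = (∀ v → δ Data.Nat.≤ deg G v) × ∃ (λ v → deg G v ≡ δ)

IsWalk : ∀ {n} → Graph n → List (Fin n) → Set
IsWalk G = Linked (Adj G)

WalkFromTo : ∀ {n} → Graph n → Fin n → Fin n → List (Fin n) → Set
WalkFromTo G u v (x ∷ xs) = (x ≡ u) × (last (x ∷ xs) ≡ just v) × IsWalk G (x ∷ xs)
WalkFromTo G u v [] = ⊥

Connected : ∀ {n} → Graph n → Set
Connected {n} G = ∀ (u v : Fin n) → ∃ (λ w → WalkFromTo G u v w)

IsPath : ∀ {n} → Graph n → List (Fin n) → Set
IsPath G p = IsWalk G p × Unique p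

-- Starting at a neighbour x of α outside S₀, extend a path greedily through vertices outside S₀
-- until its last vertex w has all its neighbours in S₀ or on the path P. No neighbour of w lies
-- in S₁, since otherwise w ∈ N(S₁) ⊆ S₀. Hence N(w), S₁ and {w} are pairwise disjoint subsets
-- of S₀ ∪ P, and δ + |S₁| + 1 ≤ deg w + |S₁| + 1 ≤ |S₀| + |P|.
module Submission where

open import Defs hiding (sym)
open import Data.Nat using (ℕ; zero; suc; _+_; _∸_; _≤_)
open import Data.Nat.Properties
  using (+-suc; +-identityʳ; m≤m+n; 1+n≰n; ≤-trans; +-monoˡ-≤; +-monoʳ-≤; m≤n+o⇒m∸n≤o; module ≤-Reasoning)
open import Data.Bool using (true; false; T)
open import Data.Bool.Properties using (T-≡)
open import Data.Fin using (Fin)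
open import Data.Fin.Properties using (any?) renaming (_≟_ to _≟ᶠ_)
open import Data.Fin.Subset using (Subset; _∈_; _∉_; _⊆_; _⊂_; ∣_∣; ⊥; ⁅_⁆; _∪_; _∩_; ⋃; Empty)
open import Data.Fin.Subset.Properties
  using (_∈?_; x∈p∪q⁺; x∈p∪q⁻; x∈p∩q⁻; x∈⁅x⁆; x∈⁅y⁆⇒x≡y; ∉⊥; ∣⁅x⁆∣≡1; ∣p∣≤n; ∣⊥∣≡0; Empty-unique; p⊆q⇒∣p∣≤∣q∣)
open import Data.List using (List; []; _∷_; length)
open import Data.List.Membership.Propositional using () renaming (_∈_ to _∈ₗ_; _∉_ to _∉ₗ_)
open import Data.List.Membership.Propositional.Properties using (∈-map⁺; ∈-filter⁺; ∈-allFin)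
import Data.List.Membership.DecPropositional as DecMembership
open import Data.List.Relation.Unary.All as All using (All; []; _∷_)
open import Data.List.Relation.Unary.All.Properties using (¬Any⇒All¬; All¬⇒¬Any)
open import Data.List.Relation.Unary.Any using (here; there)
open import Data.List.Relation.Unary.AllPairs using ([]; _∷_)
open import Data.List.Relation.Unary.Linked using ([-]; _∷_)
open import Data.List.Relation.Unary.Unique.Propositional using (Unique)
open import Data.List.Relation.Unary.Unique.Propositional.Properties using (Unique[x∷xs]⇒x∉xs)
open import Data.Vec using ([]; _∷_)
open import Data.Vec.Properties using (lookup∘tabulate; lookup⇒[]=; []=⇒lookup)
open import Data.Product using (Σ; _×_; ∃; _,_; proj₁; proj₂)
open import Data.Sum as Sum using (_⊎_; inj₁; inj₂)
open import Data.Empty using (⊥-elim)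
open import Function using (_∘_; Equivalence)
open import Relation.Nullary using (¬_; yes; no; ¬?)
open import Relation.Nullary.Decidable using (_×-dec_; T?)
open import Relation.Binary.PropositionalEquality using (_≡_; refl; sym; trans; cong; cong₂; subst; module ≡-Reasoning)

private
  variable
    n : ℕ

∣p∪q∣+∣p∩q∣≡∣p∣+∣q∣ : (p q : Subset n) → ∣ p ∪ q ∣ + ∣ p ∩ q ∣ ≡ ∣ p ∣ + ∣ q ∣
∣p∪q∣+∣p∩q∣≡∣p∣+∣q∣ [] [] = refl
∣p∪q∣+∣p∩q∣≡∣p∣+∣q∣ (true ∷ p) (true ∷ q) = cong suc (begin
  ∣ p ∪ q ∣ + suc ∣ p ∩ q ∣   ≡⟨ +-suc ∣ p ∪ q ∣ ∣ p ∩ q ∣ ⟩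
  suc (∣ p ∪ q ∣ + ∣ p ∩ q ∣) ≡⟨ cong suc (∣p∪q∣+∣p∩q∣≡∣p∣+∣q∣ p q) ⟩
  suc (∣ p ∣ + ∣ q ∣)         ≡⟨ +-suc ∣ p ∣ ∣ q ∣ ⟨
  ∣ p ∣ + suc ∣ q ∣           ∎)
  where open ≡-Reasoning
∣p∪q∣+∣p∩q∣≡∣p∣+∣q∣ (true ∷ p) (false ∷ q) = cong suc (∣p∪q∣+∣p∩q∣≡∣p∣+∣q∣ p q)
∣p∪q∣+∣p∩q∣≡∣p∣+∣q∣ (false ∷ p) (true ∷ q) =
  trans (cong suc (∣p∪q∣+∣p∩q∣≡∣p∣+∣q∣ p q)) (sym (+-suc ∣ p ∣ ∣ q ∣))
∣p∪q∣+∣p∩q∣≡∣p∣+∣q∣ (false ∷ p) (false ∷ q) = ∣p∪q∣+∣p∩q∣≡∣p∣+∣q∣ p q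

∣p∪q∣≤∣p∣+∣q∣ : (p q : Subset n) → ∣ p ∪ q ∣ ≤ ∣ p ∣ + ∣ q ∣
∣p∪q∣≤∣p∣+∣q∣ p q = subst (∣ p ∪ q ∣ ≤_) (∣p∪q∣+∣p∩q∣≡∣p∣+∣q∣ p q) (m≤m+n _ _)

Empty[p∩q]⇒∣p∪q∣≡∣p∣+∣q∣ : (p q : Subset n) → Empty (p ∩ q) → ∣ p ∪ q ∣ ≡ ∣ p ∣ + ∣ q ∣
Empty[p∩q]⇒∣p∪q∣≡∣p∣+∣q∣ {n} p q disjoint = begin
  ∣ p ∪ q ∣               ≡⟨ +-identityʳ _ ⟨
  ∣ p ∪ q ∣ + 0           ≡⟨ cong (∣ p ∪ q ∣ +_) (∣⊥∣≡0 n) ⟨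
  ∣ p ∪ q ∣ + ∣ ⊥ {n} ∣   ≡⟨ cong (λ r → ∣ p ∪ q ∣ + ∣ r ∣) (Empty-unique disjoint) ⟨
  ∣ p ∪ q ∣ + ∣ p ∩ q ∣   ≡⟨ ∣p∪q∣+∣p∩q∣≡∣p∣+∣q∣ p q ⟩
  ∣ p ∣ + ∣ q ∣           ∎
  where open ≡-Reasoning

fromList : List (Fin n) → Subset n
fromList []       = ⊥
fromList (x ∷ xs) = ⁅ x ⁆ ∪ fromList xs

∈fromList⁺ : {x : Fin n} (xs : List (Fin n)) → x ∈ₗ xs → x ∈ fromList xs
∈fromList⁺ (y ∷ xs) (here refl) = x∈p∪q⁺ (inj₁ (x∈⁅x⁆ y))
∈fromList⁺ (y ∷ xs) (there x∈xs) = x∈p∪q⁺ (inj₂ (∈fromList⁺ xs x∈xs))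

∈fromList⁻ : {x : Fin n} (xs : List (Fin n)) → x ∈ fromList xs → x ∈ₗ xs
∈fromList⁻ [] x∈⊥ = ⊥-elim (∉⊥ x∈⊥)
∈fromList⁻ (y ∷ xs) x∈ with x∈p∪q⁻ ⁅ y ⁆ (fromList xs) x∈
... | inj₁ x∈⁅y⁆ = here (x∈⁅y⁆⇒x≡y y x∈⁅y⁆)
... | inj₂ x∈xs  = there (∈fromList⁻ xs x∈xs)

Unique⇒∣fromList∣≡length : (xs : List (Fin n)) → Unique xs → ∣ fromList xs ∣ ≡ length xs
Unique⇒∣fromList∣≡length {n} [] _ = ∣⊥∣≡0 n
Unique⇒∣fromList∣≡length (x ∷ xs) (x≢xs ∷ unique) = begin
  ∣ ⁅ x ⁆ ∪ fromList xs ∣       ≡⟨ Empty[p∩q]⇒∣p∪q∣≡∣p∣+∣q∣ ⁅ x ⁆ (fromList xs) disjoint ⟩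
  ∣ ⁅ x ⁆ ∣ + ∣ fromList xs ∣   ≡⟨ cong₂ _+_ (∣⁅x⁆∣≡1 x) (Unique⇒∣fromList∣≡length xs unique) ⟩
  suc (length xs)               ∎
  where
  open ≡-Reasoning
  disjoint : Empty (⁅ x ⁆ ∩ fromList xs)
  disjoint (y , y∈) with x∈p∩q⁻ ⁅ x ⁆ (fromList xs) y∈
  ... | y∈⁅x⁆ , y∈xs rewrite x∈⁅y⁆⇒x≡y x y∈⁅x⁆ = All¬⇒¬Any x≢xs (∈fromList⁻ xs y∈xs)

Unique⇒length≤n : (xs : List (Fin n)) → Unique xs → length xs ≤ n
Unique⇒length≤n xs unique = subst (_≤ _) (Unique⇒∣fromList∣≡length xs unique) (∣p∣≤n (fromList xs))

module _ (G : Graph n) where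

  Adj-sym : {u v : Fin n} → Adj G u v → Adj G v u
  Adj-sym {u} {v} = subst T (Graph.sym G u v)

  Adj-irrefl : {v : Fin n} → ¬ Adj G v v
  Adj-irrefl {v} = subst T (Graph.irrefl G v)

  Adj⇒∈N : {u v : Fin n} → Adj G u v → v ∈ N G u
  Adj⇒∈N {u} {v} u~v =
    lookup⇒[]= v (N G u) (trans (lookup∘tabulate (adj G u) v) (Equivalence.to T-≡ u~v))

  ∈N⇒Adj : {u v : Fin n} → v ∈ N G u → Adj G u v
  ∈N⇒Adj {u} {v} v∈N =
    Equivalence.from T-≡ (trans (sym (lookup∘tabulate (adj G u) v)) ([]=⇒lookup v∈N))

  ∈N⇒∈NSet : {S : Subset n} {u v : Fin n} → u ∈ S → v ∈ N G u → v ∈ NSet G S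
  ∈N⇒∈NSet {S} {u} {v} u∈S v∈N = ∈⋃ (∈-map⁺ (N G) (∈-filter⁺ (_∈? S) (∈-allFin u) u∈S))
    where
    ∈⋃ : {ps : List (Subset n)} → N G u ∈ₗ ps → v ∈ ⋃ ps
    ∈⋃ (here refl) = x∈p∪q⁺ (inj₁ v∈N)
    ∈⋃ (there p∈ps) = x∈p∪q⁺ (inj₂ (∈⋃ p∈ps))

  ∣T∣+deg+1≤∣S∣+∣P∣ : {S T P : Subset n} {w : Fin n} → T ⊆ S → NSet G T ⊆ S →
    w ∉ S → w ∈ P → N G w ⊆ S ∪ P → ∣ T ∣ + deg G w + 1 ≤ ∣ S ∣ + ∣ P ∣
  ∣T∣+deg+1≤∣S∣+∣P∣ {S} {T} {P} {w} T⊆S N[T]⊆S w∉S w∈P N[w]⊆S∪P = begin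
    ∣ T ∣ + ∣ N G w ∣ + 1           ≡⟨ cong (∣ T ∣ + ∣ N G w ∣ +_) (∣⁅x⁆∣≡1 w) ⟨
    ∣ T ∣ + ∣ N G w ∣ + ∣ ⁅ w ⁆ ∣   ≡⟨ cong (_+ ∣ ⁅ w ⁆ ∣) (Empty[p∩q]⇒∣p∪q∣≡∣p∣+∣q∣ T (N G w) T∩N[w]-empty) ⟨
    ∣ T ∪ N G w ∣ + ∣ ⁅ w ⁆ ∣       ≡⟨ Empty[p∩q]⇒∣p∪q∣≡∣p∣+∣q∣ (T ∪ N G w) ⁅ w ⁆ w-fresh ⟨
    ∣ (T ∪ N G w) ∪ ⁅ w ⁆ ∣         ≤⟨ p⊆q⇒∣p∣≤∣q∣ covered ⟩
    ∣ S ∪ P ∣                       ≤⟨ ∣p∪q∣≤∣p∣+∣q∣ S P ⟩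
    ∣ S ∣ + ∣ P ∣                   ∎
    where
    open ≤-Reasoning
    T∩N[w]-empty : Empty (T ∩ N G w)
    T∩N[w]-empty (v , v∈) with x∈p∩q⁻ T (N G w) v∈
    ... | v∈T , v∈N[w] = w∉S (N[T]⊆S (∈N⇒∈NSet v∈T (Adj⇒∈N (Adj-sym (∈N⇒Adj v∈N[w])))))
    w-fresh : Empty ((T ∪ N G w) ∩ ⁅ w ⁆)
    w-fresh (v , v∈) with x∈p∩q⁻ (T ∪ N G w) ⁅ w ⁆ v∈
    ... | v∈T∪N , v∈⁅w⁆ rewrite x∈⁅y⁆⇒x≡y w v∈⁅w⁆ with x∈p∪q⁻ T (N G w) v∈T∪N
    ... | inj₁ w∈T    = w∉S (T⊆S w∈T)
    ... | inj₂ w∈N[w] = Adj-irrefl (∈N⇒Adj w∈N[w])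
    covered : (T ∪ N G w) ∪ ⁅ w ⁆ ⊆ S ∪ P
    covered v∈ with x∈p∪q⁻ (T ∪ N G w) ⁅ w ⁆ v∈
    ... | inj₂ v∈⁅w⁆ rewrite x∈⁅y⁆⇒x≡y w v∈⁅w⁆ = x∈p∪q⁺ (inj₂ w∈P)
    ... | inj₁ v∈T∪N with x∈p∪q⁻ T (N G w) v∈T∪N
    ... | inj₁ v∈T    = x∈p∪q⁺ (inj₁ (T⊆S v∈T))
    ... | inj₂ v∈N[w] = N[w]⊆S∪P v∈N[w]

module _ (G : Graph n) (S : Subset n) where

  open DecMembership (_≟ᶠ_ {n}) using () renaming (_∈?_ to _∈ₗ?_)

  neighbourOutside? : (y : Fin n) (W : List (Fin n)) →
    (∃ λ z → Adj G y z × z ∉ S × z ∉ₗ W) ⊎ (∀ {u} → Adj G y u → u ∈ S ⊎ u ∈ₗ W)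
  neighbourOutside? y W with any? (λ z → T? (adj G y z) ×-dec ¬? (z ∈? S) ×-dec ¬? (z ∈ₗ? W))
  ... | yes found = inj₁ found
  ... | no none = inj₂ inside
    where
    inside : ∀ {u} → Adj G y u → u ∈ S ⊎ u ∈ₗ W
    inside {u} y~u with u ∈? S
    ... | yes u∈S = inj₁ u∈S
    ... | no u∉S with u ∈ₗ? W
    ...   | yes u∈W = inj₂ u∈W
    ...   | no u∉W  = ⊥-elim (none (u , y~u , u∉S , u∉W))

  record MaximalPath (V : List (Fin n)) (y : Fin n) : Set where
    field
      rest    : List (Fin n)
      end     : Fin n
      isPath  : IsPath G (y ∷ rest)
      outside : All (_∉ S) (y ∷ rest)
      fresh   : All (_∉ₗ V) (y ∷ rest)
      end∈    : end ∈ₗ y ∷ rest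
      closed  : ∀ {u} → Adj G end u → u ∈ S ⊎ u ∈ₗ V ⊎ u ∈ₗ y ∷ rest

  ∈-shift : {u y : Fin n} {V P : List (Fin n)} → u ∈ₗ y ∷ V ⊎ u ∈ₗ P → u ∈ₗ V ⊎ u ∈ₗ y ∷ P
  ∈-shift (inj₁ (here u≡y))  = inj₂ (here u≡y)
  ∈-shift (inj₁ (there u∈V)) = inj₁ u∈V
  ∈-shift (inj₂ u∈P)         = inj₂ (there u∈P)

  prepend : {y z : Fin n} {V : List (Fin n)} → Adj G y z → y ∉ S → y ∉ₗ V →
    MaximalPath (y ∷ V) z → MaximalPath V y
  prepend {z = z} y~z y∉S y∉V p = record
    { rest    = z ∷ rest
    ; end     = end
    ; isPath  = y~z ∷ proj₁ isPath , All.map (λ u∉y∷V y≡u → u∉y∷V (here (sym y≡u))) fresh ∷ proj₂ isPath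
    ; outside = y∉S ∷ outside
    ; fresh   = y∉V ∷ All.map (_∘ there) fresh
    ; end∈    = there end∈
    ; closed  = Sum.map₂ ∈-shift ∘ closed
    }
    where open MaximalPath p

  -- Running out of fuel is impossible: z ∷ y ∷ V would be a duplicate-free list of more than n vertices.
  maximalPath : (k : ℕ) (y : Fin n) (V : List (Fin n)) →
    n ≤ k + length (y ∷ V) → Unique (y ∷ V) → y ∉ S → MaximalPath V y
  maximalPath k y V fuel unique y∉S with neighbourOutside? y (y ∷ V)
  ... | inj₂ closed = record
    { rest = [] ; end = y ; isPath = [-] , [] ∷ [] ; outside = y∉S ∷ []
    ; fresh = Unique[x∷xs]⇒x∉xs unique ∷ [] ; end∈ = here refl
    ; closed = Sum.map₂ (∈-shift ∘ inj₁) ∘ closed }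
  maximalPath zero y V fuel unique y∉S | inj₁ (z , _ , _ , z∉y∷V) =
    ⊥-elim (1+n≰n (≤-trans (Unique⇒length≤n (z ∷ y ∷ V) (¬Any⇒All¬ _ z∉y∷V ∷ unique)) fuel))
  maximalPath (suc k) y V fuel unique y∉S | inj₁ (z , y~z , z∉S , z∉y∷V) =
    prepend y~z y∉S (Unique[x∷xs]⇒x∉xs unique)
      (maximalPath k z (y ∷ V) (subst (n ≤_) (sym (+-suc k (length (y ∷ V)))) fuel)
        (¬Any⇒All¬ _ z∉y∷V ∷ unique) z∉S)

lemma2p4 : ∀ {n : ℕ} (G : Graph n) (δ : ℕ) → Connected G → IsMinDegree G δ →
    (S₀ S₁ : Subset n) → S₁ ⊂ S₀ → NSet G S₁ ⊆ S₀ →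
    (α : Fin n) → α ∈ S₀ → ¬ (N G α ⊆ S₀) →
    Σ (Fin n) (λ x → Σ (List (Fin n)) (λ xs →
      Adj G α x × IsPath G (x ∷ xs) × All (λ v → v ∉ S₀) (x ∷ xs)
      × (∣ S₁ ∣ + δ + 1) ∸ ∣ S₀ ∣ ≤ length (x ∷ xs)))
lemma2p4 {n} G δ _ (δ≤deg , _) S₀ S₁ (S₁⊆S₀ , _) N[S₁]⊆S₀ α _ N[α]⊈S₀
  with neighbourOutside? G S₀ α []
... | inj₂ N[α]⊆S₀∪[] = ⊥-elim (N[α]⊈S₀ N[α]⊆S₀)
  where
  N[α]⊆S₀ : N G α ⊆ S₀
  N[α]⊆S₀ x∈N with N[α]⊆S₀∪[] (∈N⇒Adj G x∈N)
  ... | inj₁ x∈S₀ = x∈S₀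
... | inj₁ (x , α~x , x∉S₀ , _) =
  x , rest , α~x , isPath , outside , m≤n+o⇒m∸n≤o _ ∣ S₀ ∣ (begin
    ∣ S₁ ∣ + δ + 1                 ≤⟨ +-monoˡ-≤ 1 (+-monoʳ-≤ ∣ S₁ ∣ (δ≤deg end)) ⟩
    ∣ S₁ ∣ + deg G end + 1         ≤⟨ ∣T∣+deg+1≤∣S∣+∣P∣ G S₁⊆S₀ N[S₁]⊆S₀ (All.lookup outside end∈)
                                        (∈fromList⁺ P end∈) N[end]⊆S₀∪P ⟩
    ∣ S₀ ∣ + ∣ fromList P ∣        ≡⟨ cong (∣ S₀ ∣ +_) (Unique⇒∣fromList∣≡length P (proj₂ isPath)) ⟩
    ∣ S₀ ∣ + length P              ∎)
  where
  open ≤-Reasoning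
  open MaximalPath (maximalPath G S₀ n x [] (m≤m+n n 1) ([] ∷ []) x∉S₀)
  P = x ∷ rest
  N[end]⊆S₀∪P : N G end ⊆ S₀ ∪ fromList P
  N[end]⊆S₀∪P u∈N with closed (∈N⇒Adj G u∈N)
  ... | inj₁ u∈S₀ = x∈p∪q⁺ (inj₁ u∈S₀)
  ... | inj₂ (inj₂ u∈P) = x∈p∪q⁺ (inj₂ (∈fromList⁺ P u∈P))
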